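{- Let $\alpha=(a_1,\dots,a_n)$ be a classical parking function and suppose $a_i=j$ is an $\alpha$-critical maxima. Then exactly $j$ of the terms $a_1,\dots,a_n$ are less than $j$.
   Context: A classical parking function of length $n$ is a sequence $(a_1,\dots,a_n)$ of nonnegative integers whose nondecreasing rearrangement $b_1\le\dots\le b_n$ satisfies $b_k\le k-1$ for all $k$. A term $a_i=j$ is an $\alpha$-critical maxima if exactly $n-1-j$ of the terms $a_1,\dots,a_n$ are larger than $j$, and $k<i$ for every $k$ with $a_k>j$. -}

module Defs where

open import Data.Nat using (ℕ; _≤_; _<_; _∸_; _<?_)
open import Data.Nat.Properties using (≤-decTotalOrder)
open import Data.Fin using (Fin; toℕ) renaming (_<_ to _<ᶠ_)
open import Data.List using (List; length; lookup)
open import Data.Vec using (Vec; toList; count) renaming (lookup to vlookup)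
open import Data.Product using (_×_)
open import Relation.Binary.PropositionalEquality using (_≡_)
import Data.List.Sort as Sort

open Sort ≤-decTotalOrder using (sort)

rearr : ∀ {n} → Vec ℕ n → List ℕ
rearr α = sort (toList α)

-- Classical parking function: b_k ≤ k - 1 for all k (0-indexed: b at position k is ≤ k).
IsParkingFunction : ∀ {n} → Vec ℕ n → Set
IsParkingFunction α = ∀ (k : Fin (length (rearr α))) → lookup (rearr α) k ≤ toℕ k

#larger : ∀ {n} → ℕ → Vec ℕ n → ℕ
#larger j α = count (j <?_) α

#smaller : ∀ {n} → ℕ → Vec ℕ n → ℕ
#smaller j α = count (_<? j) α

IsCriticalMaxima : ∀ {n} → Vec ℕ n → Fin n → Set
IsCriticalMaxima {n} α i =
  (#larger j α ≡ n ∸ 1 ∸ j) × (∀ (k : Fin n) → j < vlookup α k → k <ᶠ i)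
  where j = vlookup α i

module Submission where

-- Proof idea.  Let j = aᵢ, s = #{k | a_k < j} and L = #{k | a_k > j}.
--
-- The terms below j, the terms above j and the term aᵢ = j
--   itself are pairwise distinct positions, so s + L + 1 ≤ n.  Criticality
--   gives L = n - 1 - j, hence s ≤ j as soon as j ≤ n - 1.
-- * Lower bound.  In the sorted rearrangement b of α the parking condition
--   gives b_k ≤ k, so the first min(j, n) entries of b are all < j; counting
--   is invariant under the permutation α ↦ b, hence min(j, n) ≤ s.
-- * Combining: if j ≥ n the lower bound gives n ≤ s < n, impossible; so
--   j ≤ n - 1 and both bounds give s = j.

open import Defs
open import Data.Nat using (ℕ)
open import Data.Fin using (Fin)
open import Data.Vec using (Vec; lookup)
open import Relation.Binary.PropositionalEquality using (_≡_)

open import Data.Nat using (zero; suc; _+_; _∸_; _≤_; _<_; _<?_; _≤?_; z≤n; s≤s)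
open import Data.Nat.Properties
open import Data.Fin using (toℕ) renaming (zero to fzero; suc to fsuc)
open import Data.List using (List; []; _∷_; length; filter) renaming (lookup to llookup)
open import Data.List.Properties using (filter-accept)
open import Data.Vec using (toList; count) renaming (_∷_ to _∷ᵥ_; [] to []ᵥ)
open import Data.Vec.Properties using (length-toList)
open import Data.List.Relation.Binary.Permutation.Propositional.Properties
  using (↭-length; filter-↭)
open import Data.Product using (_,_)
open import Data.Empty using (⊥-elim)
open import Level using (Level)
open import Relation.Nullary using (¬_; yes; no)
open import Relation.Unary using (Pred; Decidable)
open import Relation.Binary.PropositionalEquality using (refl; sym; trans; cong; subst)
import Data.List.Sort as Sort
open Sort ≤-decTotalOrder using (sort; sort-↭)

module _ {a p q : Level} {A : Set a} {P : Pred A p} {Q : Pred A q}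
         (P? : Decidable P) (Q? : Decidable Q) where

  count-disjoint : (∀ x → P x → ¬ Q x) →
                   ∀ {n} (xs : Vec A n) → count P? xs + count Q? xs ≤ n
  count-disjoint disj []ᵥ = z≤n
  count-disjoint disj {suc n} (x ∷ᵥ xs) with P? x | Q? x
  ... | yes px | yes qx = ⊥-elim (disj x px qx)
  ... | yes _  | no _   = s≤s (count-disjoint disj xs)
  ... | no _   | yes _  = subst (_≤ suc n) (sym (+-suc (count P? xs) (count Q? xs)))
                                (s≤s (count-disjoint disj xs))
  ... | no _   | no _   = m≤n⇒m≤1+n (count-disjoint disj xs)

  count-disjoint-< : (∀ x → P x → ¬ Q x) →
                     ∀ {n} (xs : Vec A n) (i : Fin n) →
                     ¬ P (lookup xs i) → ¬ Q (lookup xs i) →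
                     count P? xs + count Q? xs < n
  count-disjoint-< disj (x ∷ᵥ xs) fzero ¬px ¬qx with P? x | Q? x
  ... | yes px | _      = ⊥-elim (¬px px)
  ... | no _   | yes qx = ⊥-elim (¬qx qx)
  ... | no _   | no _   = s≤s (count-disjoint disj xs)
  count-disjoint-< disj {suc n} (x ∷ᵥ xs) (fsuc i) ¬pi ¬qi with P? x | Q? x
  ... | yes px | yes qx = ⊥-elim (disj x px qx)
  ... | yes _  | no _   = s≤s (count-disjoint-< disj xs i ¬pi ¬qi)
  ... | no _   | yes _  = subst (_< suc n) (sym (+-suc (count P? xs) (count Q? xs)))
                                (s≤s (count-disjoint-< disj xs i ¬pi ¬qi))
  ... | no _   | no _   = m≤n⇒m≤1+n (count-disjoint-< disj xs i ¬pi ¬qi)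

module _ {a p : Level} {A : Set a} {P : Pred A p} (P? : Decidable P) where

  count-toList : ∀ {n} (xs : Vec A n) → count P? xs ≡ length (filter P? (toList xs))
  count-toList []ᵥ = refl
  count-toList (x ∷ᵥ xs) with P? x
  ... | yes _ = cong suc (count-toList xs)
  ... | no _  = count-toList xs

  prefix≤count : ∀ (l : List A) m → m ≤ length l →
                 (∀ k → toℕ k < m → P (llookup l k)) →
                 m ≤ length (filter P? l)
  prefix≤count l       zero    _         _      = z≤n
  prefix≤count (x ∷ l) (suc m) (s≤s m≤l) prefix =
    subst (λ ys → suc m ≤ length ys) (sym (filter-accept P? (prefix fzero (s≤s z≤n))))
          (s≤s (prefix≤count l m m≤l (λ k k<m → prefix (fsuc k) (s≤s k<m))))

-- Lower bound: in a parking function of length n, for every m ≤ min(j, n)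
-- at least m terms are smaller than j, because the m smallest ones are.
parking-lower-bound : ∀ {n} (α : Vec ℕ n) → IsParkingFunction α →
                      ∀ j m → m ≤ n → m ≤ j → m ≤ #smaller j α
parking-lower-bound {n} α parking j m m≤n m≤j = begin
  m                                        ≤⟨ prefix≤count (_<? j) b m m≤|b| small-prefix ⟩
  length (filter (_<? j) b)                ≡⟨ ↭-length (filter-↭ (_<? j) (sort-↭ (toList α))) ⟩
  length (filter (_<? j) (toList α))       ≡⟨ sym (count-toList (_<? j) α) ⟩
  #smaller j α                             ∎
  where
  open ≤-Reasoning
  b : List ℕ
  b = rearr α
  m≤|b| : m ≤ length b
  m≤|b| = subst (m ≤_) (sym (trans (↭-length (sort-↭ (toList α))) (length-toList α))) m≤n
  small-prefix : ∀ k → toℕ k < m → llookup b k < j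
  small-prefix k k<m = ≤-<-trans (parking k) (<-≤-trans k<m m≤j)

-- Upper bound: the terms below aᵢ, the terms above aᵢ and aᵢ itself are
-- distinct positions.
smaller+larger< : ∀ {n} (α : Vec ℕ n) (i : Fin n) →
                  #smaller (lookup α i) α + #larger (lookup α i) α < n
smaller+larger< α i =
  count-disjoint-< (_<? j) (j <?_) (λ x x<j j<x → <-asym x<j j<x) α i
                   (<-irrefl refl) (<-irrefl refl)
  where
  j : ℕ
  j = lookup α i

lemma3p6 : ∀ (n : ℕ) (α : Vec ℕ n) (i : Fin n) →
    IsParkingFunction α → IsCriticalMaxima α i →
    #smaller (lookup α i) α ≡ lookup α i
-- If aᵢ > n - 1 the lower
-- bound would force every term below aᵢ, contradicting s + L < n.
lemma3p6 (suc n) α i parking (larger≡ , _) with lookup α i ≤? n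
... | no j≰n = ⊥-elim (<⇒≱ s<1+n (lower (suc n) ≤-refl (≰⇒> j≰n)))
  where
  s<1+n : #smaller (lookup α i) α < suc n
  s<1+n = ≤-<-trans (m≤m+n _ _) (smaller+larger< α i)
  lower : ∀ m → m ≤ suc n → m ≤ lookup α i → m ≤ #smaller (lookup α i) α
  lower = parking-lower-bound α parking (lookup α i)
... | yes j≤n = ≤-antisym upper (parking-lower-bound α parking j j (m≤n⇒m≤1+n j≤n) ≤-refl)
  where
  j s : ℕ
  j = lookup α i
  s = #smaller j α
  upper : s ≤ j
  upper = +-cancelʳ-≤ (n ∸ j) s j (begin
    s + (n ∸ j)        ≡⟨ cong (s +_) (sym larger≡) ⟩
    s + #larger j α    ≤⟨ ≤-pred (smaller+larger< α i) ⟩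
    n                  ≡⟨ sym (m+[n∸m]≡n j≤n) ⟩
    j + (n ∸ j)        ∎)
    where open ≤-Reasoning
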